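{- Let $r,s\geq 1$. If every subgraph of a graph $G$ has a vertex of degree at most one or a vertex of degree at most $s$ all of whose neighbors have degree at most $r$ (degrees taken in that subgraph), then $G$ is $(s,r+1)$-degenerate.
   Context: A graph $H$ is $(d,\Delta)$-degenerate if there is an ordering $v_1,\ldots,v_n$ of its vertices such that for each $v_i$: (1) at most $d$ vertices $v_j$ with $j<i$ are adjacent to $v_i$, and (2) there are at most $\Delta$ subsets $S\subset\{v_1,\ldots,v_i\}$ such that $S=N(v_j)\cap\{v_1,\ldots,v_i\}$ for some neighbor $v_j$ of $v_i$ with $j>i$, where $N(v)$ is the set of neighbors of $v$. -}

module Defs where

open import Data.Nat using (ℕ; _≤_; _<_)
open import Data.Bool using (Bool; true; false; _∧_)
open import Data.Fin using (Fin; toℕ)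
open import Data.Fin.Subset using (Subset; ∣_∣; _∈_; Nonempty)
open import Data.Fin.Permutation using (Permutation′; _⟨$⟩ʳ_; _⟨$⟩ˡ_)
open import Data.Vec using (tabulate)
open import Data.List using (List; length)
import Data.List.Membership.Propositional as LM
open import Data.Product using (Σ; _×_; ∃)
open import Data.Sum using (_⊎_)
open import Relation.Binary.PropositionalEquality using (_≡_)
open import Relation.Nullary using (does)
import Data.Nat as N

record Graph (n : ℕ) : Set where
  field
    adj     : Fin n → Fin n → Bool
    adj-sym : ∀ u v → adj u v ≡ adj v u
    irrefl  : ∀ v → adj v v ≡ false
open Graph public

record Subgraph {n : ℕ} (G : Graph n) : Set where
  field
    verts     : Subset n
    edges     : Fin n → Fin n → Bool
    edges-sym : ∀ u v → edges u v ≡ edges v u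
    edges-adj : ∀ u v → edges u v ≡ true → adj G u v ≡ true
    edges-in  : ∀ u v → edges u v ≡ true → (u ∈ verts) × (v ∈ verts)
open Subgraph public

degIn : ∀ {n} {G : Graph n} → Subgraph G → Fin n → ℕ
degIn H v = ∣ tabulate (edges H v) ∣

GoodVertexProperty : ∀ {n} → ℕ → ℕ → Graph n → Set
GoodVertexProperty {n} r s G =
  (H : Subgraph G) → Nonempty (verts H) →
  Σ (Fin n) λ v → (v ∈ verts H) ×
    ( (degIn H v ≤ 1)
    ⊎ ((degIn H v ≤ s) × (∀ u → edges H v u ≡ true → degIn H u ≤ r)))

-- An ordering v_1..v_n: σ maps positions to vertices; position of u is σ ⟨$⟩ˡ u.
-- Vertices strictly before position i.
before : ∀ {n} → Permutation′ n → Fin n → Subset n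
before σ i = tabulate λ u → does (toℕ (σ ⟨$⟩ˡ u) N.<? toℕ i)

prefix : ∀ {n} → Permutation′ n → Fin n → Subset n
prefix σ i = tabulate λ u → does (toℕ (σ ⟨$⟩ˡ u) N.≤? toℕ i)

traceOn : ∀ {n} → Graph n → Fin n → Subset n → Subset n
traceOn G v S = tabulate λ u → adj G v u ∧ Data.Vec.lookup S u
  where import Data.Vec

DegenerateOrdering : ∀ {n} → ℕ → ℕ → Graph n → Permutation′ n → Set
DegenerateOrdering {n} d Δ G σ = ∀ (i : Fin n) →
  let vi = σ ⟨$⟩ʳ i in
  (∣ traceOn G vi (before σ i) ∣ ≤ d) ×
  -- the set { N(v_j) ∩ {v_1..v_i} : j > i, v_j ~ v_i } has at most Δ elements:
  -- it is covered by a list of length ≤ Δ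
  (Σ (List (Subset n)) λ L → (length L ≤ Δ) ×
     (∀ (j : Fin n) → toℕ i < toℕ j → adj G vi (σ ⟨$⟩ʳ j) ≡ true →
        traceOn G (σ ⟨$⟩ʳ j) (prefix σ i) LM.∈ L))

Degenerate : ∀ {n} → ℕ → ℕ → Graph n → Set
Degenerate {n} d Δ G = Σ (Permutation′ n) (DegenerateOrdering d Δ G)

module Submission where

-- Fill the ordering from the last position down: at position i put a good vertex of the
-- subgraph induced on the vertices not yet placed, i.e. on the prefix v₁,…,vᵢ; such a vertex
-- exists by hypothesis. Then vᵢ has at most s earlier neighbours. A later neighbour vⱼ of vᵢ
-- either has degree at most 1 in its own prefix, and then N(vⱼ) ∩ {v₁,…,vᵢ} = {vᵢ}, or all
-- neighbours of vⱼ have degree at most r there. All later neighbours of the second kind lie in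
-- the prefix of the latest one w among them, and vᵢ is a neighbour of w in that prefix, so there
-- are at most r of them. Hence at most r + 1 distinct traces occur.

open import Defs
open import Data.Nat using (ℕ; suc; _≤_; _<_; _+_; z≤n; s≤s)
import Data.Nat.Properties as ℕ
open import Data.Bool using (Bool; true; false; _∧_)
open import Data.Bool.Properties using (∧-comm) renaming (_≟_ to _≟ᵇ_)
open import Data.Fin using (Fin; toℕ; fromℕ; inject₁; _≟_)
import Data.Fin.Properties as Fin
open import Data.Fin.Induction using (>-weakInduction)
open import Data.Fin.Subset using (Subset; inside; outside; ∣_∣; _∈_; _⊆_; ⁅_⁆; Nonempty)
open import Data.Fin.Subset.Properties
  using (nonempty?; Empty-unique; ∣⊥∣≡0; x∈⁅x⁆; x∈⁅y⁆⇒x≡y; ∣⁅x⁆∣≡1; p⊆q⇒∣p∣≤∣q∣; ⊆-antisym;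
         x∈p∧x≢y⇒x∈p-y; x∈p⇒∣p-x∣<∣p∣)
open import Data.Fin.Permutation
  using (Permutation′; _⟨$⟩ʳ_; _⟨$⟩ˡ_; inverseˡ; inverseʳ; transpose; _∘ₚ_)
import Data.Fin.Permutation as Perm
import Data.Fin.Permutation.Components as PC
open import Data.Vec using ([]; _∷_; tabulate; lookup; here; there)
open import Data.Vec.Properties using (lookup∘tabulate; lookup⇒[]=; []=⇒lookup; tabulate-cong)
open import Data.List using (List; map; length)
open import Data.List.Properties using (length-map)
open import Data.List.Relation.Unary.All as All using (All)
import Data.List.Relation.Unary.All.Properties as All
open import Data.List.Relation.Unary.Any using (here; there)
import Data.List.Membership.Propositional as List
open import Data.List.Membership.Propositional.Properties using (∈-map⁺)
open import Data.List.Extrema ℕ.≤-totalOrder using (argmax; argmax-all; f[xs]≤f[argmax])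
open import Data.Product using (∃; _×_; _,_; proj₁; proj₂)
open import Data.Sum using (_⊎_; inj₁; inj₂)
open import Function using (_∘_; mk⇔)
open import Level using (Level)
open import Relation.Binary.PropositionalEquality
open import Relation.Nullary using (yes; no; does; contradiction)
open import Relation.Nullary.Decidable using (dec-true; dec-false; does-⇔; _×-dec_)
open import Relation.Unary using (Pred; Decidable)

private variable
  ℓ : Level
  n : ℕ

∧-≡-true⁻ : {a b : Bool} → a ∧ b ≡ true → a ≡ true × b ≡ true
∧-≡-true⁻ {true} {true} refl = refl , refl

∈-tabulate⁺ : {f : Fin n → Bool} {x : Fin n} → f x ≡ true → x ∈ tabulate f
∈-tabulate⁺ {f = f} {x} fx = lookup⇒[]= x (tabulate f) (trans (lookup∘tabulate f x) fx)

∈-tabulate⁻ : {f : Fin n → Bool} {x : Fin n} → x ∈ tabulate f → f x ≡ true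
∈-tabulate⁻ {f = f} {x} x∈ = trans (sym (lookup∘tabulate f x)) ([]=⇒lookup x∈)

∈-tabulate-does⁺ : {P : Pred (Fin n) ℓ} (P? : Decidable P) {x : Fin n} →
                   P x → x ∈ tabulate (does ∘ P?)
∈-tabulate-does⁺ P? {x} Px = ∈-tabulate⁺ (dec-true (P? x) Px)

∈-tabulate-does⁻ : {P : Pred (Fin n) ℓ} (P? : Decidable P) {x : Fin n} →
                   x ∈ tabulate (does ∘ P?) → P x
∈-tabulate-does⁻ P? {x} x∈ with P? x | ∈-tabulate⁻ {f = does ∘ P?} x∈
... | yes Px | _ = Px

x∈p⇒1≤∣p∣ : {p : Subset n} {x : Fin n} → x ∈ p → 1 ≤ ∣ p ∣
x∈p⇒1≤∣p∣ {p = p} {x} x∈p = subst (_≤ ∣ p ∣) (∣⁅x⁆∣≡1 x)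
  (p⊆q⇒∣p∣≤∣q∣ λ y∈⁅x⁆ → subst (_∈ p) (sym (x∈⁅y⁆⇒x≡y x y∈⁅x⁆)) x∈p)

x∈p∧∣p∣≤1⇒p≡⁅x⁆ : {p : Subset n} {x : Fin n} → x ∈ p → ∣ p ∣ ≤ 1 → p ≡ ⁅ x ⁆
x∈p∧∣p∣≤1⇒p≡⁅x⁆ {p = p} {x} x∈p ∣p∣≤1 =
  ⊆-antisym p⊆⁅x⁆ λ y∈⁅x⁆ → subst (_∈ p) (sym (x∈⁅y⁆⇒x≡y x y∈⁅x⁆)) x∈p
  where
  p⊆⁅x⁆ : p ⊆ ⁅ x ⁆
  p⊆⁅x⁆ {y} y∈p with y ≟ x
  ... | yes refl = x∈⁅x⁆ x
  ... | no y≢x = contradiction (ℕ.≤-trans (x∈p⇒∣p-x∣<∣p∣ x∈p) ∣p∣≤1)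
                   (ℕ.<⇒≱ (s≤s (x∈p⇒1≤∣p∣ (x∈p∧x≢y⇒x∈p-y y∈p y≢x))))

elements : Subset n → List (Fin n)
elements []            = List.[]
elements (inside  ∷ p) = Fin.zero List.∷ map Fin.suc (elements p)
elements (outside ∷ p) = map Fin.suc (elements p)

length-elements : (p : Subset n) → length (elements p) ≡ ∣ p ∣
length-elements []            = refl
length-elements (inside  ∷ p) =
  cong suc (trans (length-map Fin.suc (elements p)) (length-elements p))
length-elements (outside ∷ p) = trans (length-map Fin.suc (elements p)) (length-elements p)

∈-elements : {p : Subset n} {x : Fin n} → x ∈ p → x List.∈ elements p
∈-elements {p = inside ∷ p}  here        = here refl
∈-elements {p = inside ∷ p}  (there x∈p) = there (∈-map⁺ Fin.suc (∈-elements x∈p))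
∈-elements {p = outside ∷ p} (there x∈p) = ∈-map⁺ Fin.suc (∈-elements x∈p)

elements-∈ : (p : Subset n) → All (_∈ p) (elements p)
elements-∈ []            = All.[]
elements-∈ (inside  ∷ p) = here All.∷ All.map⁺ (All.map there (elements-∈ p))
elements-∈ (outside ∷ p) = All.map⁺ (All.map there (elements-∈ p))

∃-argmax : (f : Fin n → ℕ) {p : Subset n} {x : Fin n} → x ∈ p →
           ∃ λ w → w ∈ p × (∀ {y} → y ∈ p → f y ≤ f w)
∃-argmax f {p} {x} x∈p =
  argmax f x (elements p) ,
  argmax-all f x∈p (elements-∈ p) ,
  λ y∈p → All.lookup (f[xs]≤f[argmax] x (elements p)) (∈-elements y∈p)

transpose-preserves : (P : Pred (Fin n) ℓ) {i j : Fin n} → P i → P j →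
                      (k : Fin n) → P k → P (PC.transpose i j k)
transpose-preserves P {i} {j} Pi Pj k Pk with does (k ≟ i)
... | true = Pj
... | false with does (k ≟ j)
...   | true  = Pi
...   | false = Pk

transpose-matchˡ : (i j : Fin n) → PC.transpose i j i ≡ j
transpose-matchˡ i j rewrite dec-true (i ≟ i) refl = refl

transpose-fixes : {i j k : Fin n} → k ≢ i → k ≢ j → PC.transpose i j k ≡ k
transpose-fixes {i = i} {j} {k} k≢i k≢j
  rewrite dec-false (k ≟ i) k≢i | dec-false (k ≟ j) k≢j = refl

module _ (σ : Permutation′ n) where

  ∈-prefix⁺ : {i x : Fin n} → toℕ (σ ⟨$⟩ˡ x) ≤ toℕ i → x ∈ prefix σ i
  ∈-prefix⁺ {i} = ∈-tabulate-does⁺ (λ x → toℕ (σ ⟨$⟩ˡ x) ℕ.≤? toℕ i)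

  ∈-prefix⁻ : {i x : Fin n} → x ∈ prefix σ i → toℕ (σ ⟨$⟩ˡ x) ≤ toℕ i
  ∈-prefix⁻ {i} = ∈-tabulate-does⁻ (λ x → toℕ (σ ⟨$⟩ˡ x) ℕ.≤? toℕ i)

  ∈-prefix-self : (i : Fin n) → σ ⟨$⟩ʳ i ∈ prefix σ i
  ∈-prefix-self i = ∈-prefix⁺ (ℕ.≤-reflexive (cong toℕ (inverseˡ σ)))

  prefix-mono : {i j : Fin n} → toℕ i ≤ toℕ j → prefix σ i ⊆ prefix σ j
  prefix-mono i≤j x∈ = ∈-prefix⁺ (ℕ.≤-trans (∈-prefix⁻ x∈) i≤j)

  before⊆prefix : (i : Fin n) → before σ i ⊆ prefix σ i
  before⊆prefix i x∈ =
    ∈-prefix⁺ (ℕ.<⇒≤ (∈-tabulate-does⁻ (λ x → toℕ (σ ⟨$⟩ˡ x) ℕ.<? toℕ i) x∈))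

  prefix-transpose : {p q i : Fin n} → toℕ p ≤ toℕ i → toℕ q ≤ toℕ i →
                     prefix (transpose p q ∘ₚ σ) i ≡ prefix σ i
  prefix-transpose {p} {q} {i} p≤i q≤i = tabulate-cong λ x →
    let k = σ ⟨$⟩ˡ x in
    does-⇔ (mk⇔ (subst Below (PC.transpose-inverse p q)
                   ∘ transpose-preserves Below p≤i q≤i (PC.transpose q p k))
                (transpose-preserves Below q≤i p≤i k))
           (_ ℕ.≤? _) (_ ℕ.≤? _)
    where
    Below : Pred (Fin n) _
    Below y = toℕ y ≤ toℕ i

module _ {n : ℕ} (Q : Subset n → Fin n → Set ℓ)
         (choose : ∀ S → Nonempty S → ∃ λ v → v ∈ S × Q S v) where

  OrderedFrom : Permutation′ n → ℕ → Set ℓ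
  OrderedFrom σ t = ∀ i → t ≤ toℕ i → Q (prefix σ i) (σ ⟨$⟩ʳ i)

  orderedFrom-extend : (σ : Permutation′ n) (p : Fin n) →
                       OrderedFrom σ (suc (toℕ p)) → ∃ λ τ → OrderedFrom τ (toℕ p)
  orderedFrom-extend σ p ordered with choose (prefix σ p) (σ ⟨$⟩ʳ p , ∈-prefix-self σ p)
  ... | v , v∈prefix , Qv = transpose p q ∘ₚ σ , ordered′
    where
    q : Fin n
    q = σ ⟨$⟩ˡ v
    q≤p : toℕ q ≤ toℕ p
    q≤p = ∈-prefix⁻ σ v∈prefix
    ordered′ : OrderedFrom (transpose p q ∘ₚ σ) (toℕ p)
    ordered′ i p≤i rewrite prefix-transpose σ p≤i (ℕ.≤-trans q≤p p≤i) with ℕ.m≤n⇒m<n∨m≡n p≤i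
    ... | inj₁ p<i =
      subst (Q (prefix σ i)) (cong (σ ⟨$⟩ʳ_) (sym (transpose-fixes i≢p i≢q))) (ordered i p<i)
      where
      i≢p : i ≢ p
      i≢p refl = ℕ.<-irrefl refl p<i
      i≢q : i ≢ q
      i≢q refl = ℕ.<⇒≱ p<i q≤p
    ... | inj₂ p≡i with refl ← Fin.toℕ-injective p≡i =
      subst (Q (prefix σ p)) (sym (trans (cong (σ ⟨$⟩ʳ_) (transpose-matchˡ p q)) (inverseʳ σ))) Qv

  ∃-ordering : ∃ λ σ → ∀ i → Q (prefix σ i) (σ ⟨$⟩ʳ i)
  ∃-ordering =
    let σ , ordered = >-weakInduction Stage start step Fin.zero in σ , λ i → ordered i z≤n
    where
    Stage : Pred (Fin (suc n)) ℓ
    Stage t = ∃ λ σ → OrderedFrom σ (toℕ t)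
    start : Stage (fromℕ n)
    start = Perm.id , λ i n≤i →
      contradiction (subst (_≤ toℕ i) (Fin.toℕ-fromℕ n) n≤i) (ℕ.<⇒≱ (Fin.toℕ<n i))
    step : ∀ p → Stage (Fin.suc p) → Stage (inject₁ p)
    step p (σ , ordered) =
      let τ , ordered′ = orderedFrom-extend σ p ordered
      in τ , subst (OrderedFrom τ) (sym (Fin.toℕ-inject₁ p)) ordered′

degree : Graph n → Subset n → Fin n → ℕ
degree G S v = ∣ traceOn G v S ∣

IsGoodIn : ℕ → ℕ → Graph n → Subset n → Fin n → Set
IsGoodIn r s G S v =
  degree G S v ≤ 1 ⊎ (degree G S v ≤ s × (∀ u → adj G v u ≡ true → u ∈ S → degree G S u ≤ r))

induced : (G : Graph n) → Subset n → Subgraph G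
induced G S = record
  { verts     = S
  ; edges     = λ u v → adj G u v ∧ (lookup S u ∧ lookup S v)
  ; edges-sym = λ u v → cong₂ _∧_ (adj-sym G u v) (∧-comm (lookup S u) (lookup S v))
  ; edges-adj = λ u v e → proj₁ (∧-≡-true⁻ {adj G u v} e)
  ; edges-in  = λ u v e →
      let u∈S , v∈S = ∧-≡-true⁻ (proj₂ (∧-≡-true⁻ {adj G u v} e))
      in lookup⇒[]= u S u∈S , lookup⇒[]= v S v∈S
  }

module _ (G : Graph n) where

  ∈-traceOn⁺ : {v x : Fin n} {S : Subset n} → adj G v x ≡ true → x ∈ S → x ∈ traceOn G v S
  ∈-traceOn⁺ v~x x∈S = ∈-tabulate⁺ (cong₂ _∧_ v~x ([]=⇒lookup x∈S))

  ∈-traceOn⁻ : {v x : Fin n} {S : Subset n} → x ∈ traceOn G v S → adj G v x ≡ true × x ∈ S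
  ∈-traceOn⁻ {x = x} {S} x∈ with ∧-≡-true⁻ (∈-tabulate⁻ x∈)
  ... | v~x , x∈S = v~x , lookup⇒[]= x S x∈S

  traceOn-mono : {v : Fin n} {S T : Subset n} → S ⊆ T → traceOn G v S ⊆ traceOn G v T
  traceOn-mono S⊆T x∈ with ∈-traceOn⁻ x∈
  ... | v~x , x∈S = ∈-traceOn⁺ v~x (S⊆T x∈S)

  traceOn≡⁅⁆ : {u v : Fin n} {S T : Subset n} → adj G u v ≡ true → v ∈ S → S ⊆ T →
               degree G T u ≤ 1 → traceOn G u S ≡ ⁅ v ⁆
  traceOn≡⁅⁆ u~v v∈S S⊆T deg≤1 =
    x∈p∧∣p∣≤1⇒p≡⁅x⁆ (∈-traceOn⁺ u~v v∈S) (ℕ.≤-trans (p⊆q⇒∣p∣≤∣q∣ (traceOn-mono S⊆T)) deg≤1)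

  degIn-induced : {S : Subset n} {u : Fin n} → u ∈ S → degIn (induced G S) u ≡ degree G S u
  degIn-induced u∈S rewrite []=⇒lookup u∈S = refl

  edges-induced : {S : Subset n} {u v : Fin n} → adj G u v ≡ true → u ∈ S → v ∈ S →
                  edges (induced G S) u v ≡ true
  edges-induced u~v u∈S v∈S rewrite u~v | []=⇒lookup u∈S | []=⇒lookup v∈S = refl

  goodVertexProperty⇒∃-goodIn : {r s : ℕ} → GoodVertexProperty r s G →
                                ∀ S → Nonempty S → ∃ λ v → v ∈ S × IsGoodIn r s G S v
  goodVertexProperty⇒∃-goodIn good S nonempty with good (induced G S) nonempty
  ... | v , v∈S , inj₁ deg≤1 = v , v∈S , inj₁ (subst (_≤ 1) (degIn-induced v∈S) deg≤1)
  ... | v , v∈S , inj₂ (deg≤s , nbrs) = v , v∈S , inj₂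
    ( subst (_≤ _) (degIn-induced v∈S) deg≤s
    , λ u v~u u∈S → subst (_≤ _) (degIn-induced u∈S) (nbrs u (edges-induced v~u v∈S u∈S)) )

module _ {r s : ℕ} (G : Graph n) (σ : Permutation′ n)
         (good : ∀ i → IsGoodIn r s G (prefix σ i) (σ ⟨$⟩ʳ i)) where

  private
    position : Fin n → Fin n
    position = σ ⟨$⟩ˡ_

  goodAt : ∀ u → IsGoodIn r s G (prefix σ (position u)) u
  goodAt u = subst (IsGoodIn r s G (prefix σ (position u))) (inverseʳ σ) (good (position u))

  backDegree≤s : 1 ≤ s → ∀ i → ∣ traceOn G (σ ⟨$⟩ʳ i) (before σ i) ∣ ≤ s
  backDegree≤s 1≤s i =
    ℕ.≤-trans (p⊆q⇒∣p∣≤∣q∣ (traceOn-mono G (before⊆prefix σ i))) (degree≤s (good i))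
    where
    degree≤s : ∀ {S v} → IsGoodIn r s G S v → degree G S v ≤ s
    degree≤s (inj₁ deg≤1)       = ℕ.≤-trans deg≤1 1≤s
    degree≤s (inj₂ (deg≤s , _)) = deg≤s

  module _ (i : Fin n) where
    private
      vᵢ : Fin n
      vᵢ = σ ⟨$⟩ʳ i

    HighLaterNeighbour : Pred (Fin n) _
    HighLaterNeighbour u =
      adj G vᵢ u ≡ true × toℕ i < toℕ (position u) × 1 < degree G (prefix σ (position u)) u

    highLaterNeighbour? : Decidable HighLaterNeighbour
    highLaterNeighbour? u = (adj G vᵢ u ≟ᵇ true) ×-dec (toℕ i ℕ.<? _) ×-dec (1 ℕ.<? _)

    highLaterNeighbours : Subset n
    highLaterNeighbours = tabulate (does ∘ highLaterNeighbour?)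

    ∣highLaterNeighbours∣≤r : ∣ highLaterNeighbours ∣ ≤ r
    ∣highLaterNeighbours∣≤r with nonempty? highLaterNeighbours
    ... | no empty = subst (_≤ r) (sym (trans (cong ∣_∣ (Empty-unique empty)) (∣⊥∣≡0 n))) z≤n
    ... | yes (x , x∈) with ∃-argmax (toℕ ∘ position) x∈
    ...   | w , w∈ , latest = ℕ.≤-trans (p⊆q⇒∣p∣≤∣q∣ ⊆traceOn) degree≤r
      where
      ⊆traceOn : highLaterNeighbours ⊆ traceOn G vᵢ (prefix σ (position w))
      ⊆traceOn y∈ = ∈-traceOn⁺ G (proj₁ (∈-tabulate-does⁻ highLaterNeighbour? y∈))
                                 (∈-prefix⁺ σ (latest y∈))
      degree≤r : degree G (prefix σ (position w)) vᵢ ≤ r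
      degree≤r with ∈-tabulate-does⁻ highLaterNeighbour? w∈ | goodAt w
      ... | _ , _ , 1<deg | inj₁ deg≤1 = contradiction deg≤1 (ℕ.<⇒≱ 1<deg)
      ... | vᵢ~w , i<w , _ | inj₂ (_ , nbrs) =
        nbrs vᵢ (trans (adj-sym G w vᵢ) vᵢ~w) (prefix-mono σ (ℕ.<⇒≤ i<w) (∈-prefix-self σ i))

    coveringList : List (Subset n)
    coveringList =
      ⁅ vᵢ ⁆ List.∷ map (λ u → traceOn G u (prefix σ i)) (elements highLaterNeighbours)

    length-coveringList : length coveringList ≤ r + 1
    length-coveringList
      rewrite length-map (λ u → traceOn G u (prefix σ i)) (elements highLaterNeighbours)
            | length-elements highLaterNeighbours
      = subst (suc ∣ highLaterNeighbours ∣ ≤_) (ℕ.+-comm 1 r) (s≤s ∣highLaterNeighbours∣≤r)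

    ∈-coveringList : ∀ j → toℕ i < toℕ j → adj G vᵢ (σ ⟨$⟩ʳ j) ≡ true →
                     traceOn G (σ ⟨$⟩ʳ j) (prefix σ i) List.∈ coveringList
    ∈-coveringList j i<j vᵢ~vⱼ with degree G (prefix σ j) (σ ⟨$⟩ʳ j) ℕ.≤? 1
    ... | yes deg≤1 = here (traceOn≡⁅⁆ G (trans (adj-sym G _ vᵢ) vᵢ~vⱼ) (∈-prefix-self σ i)
                                          (prefix-mono σ (ℕ.<⇒≤ i<j)) deg≤1)
    ... | no deg≰1 =
      there (∈-map⁺ _ (∈-elements (∈-tabulate-does⁺ highLaterNeighbour? (vᵢ~vⱼ , later))))
      where
      later : toℕ i < toℕ (position (σ ⟨$⟩ʳ j)) ×
              1 < degree G (prefix σ (position (σ ⟨$⟩ʳ j))) (σ ⟨$⟩ʳ j)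
      later = subst (λ k → toℕ i < toℕ k × 1 < degree G (prefix σ k) (σ ⟨$⟩ʳ j))
                    (sym (inverseˡ σ)) (i<j , ℕ.≰⇒> deg≰1)

  degenerateOrdering : 1 ≤ s → DegenerateOrdering s (r + 1) G σ
  degenerateOrdering 1≤s i =
    backDegree≤s 1≤s i , coveringList i , length-coveringList i , ∈-coveringList i

lemma4p5 : (r s : ℕ) → 1 ≤ r → 1 ≤ s → (n : ℕ) → (G : Graph n) →
    GoodVertexProperty r s G → Degenerate s (r + 1) G
lemma4p5 r s _ 1≤s n G good =
  let σ , ordered = ∃-ordering (IsGoodIn r s G) (goodVertexProperty⇒∃-goodIn G good)
  in σ , degenerateOrdering G σ ordered 1≤s
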